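{- Let $\Gamma;s$ be an extended context and $t,t',u$ terms. If $\Gamma;s\vdash t\leq^*_{\mathrm{wf}}u$ and $t\mapsto t'$, then $\Gamma;s\vdash t'\leq^*_{\mathrm{wf}}u$.
   Context: Terms: $t ::= x \mid \top \mid (\lambda x\leq t.u) \mid (u\,v)$, with $x$ from a countably infinite set of variables and $\top$ a constant; $x$ is bound in $u$ in $\lambda x\leq t.u$; terms identified up to renaming of bound variables; $\mathrm{fv}$ = free variables, $u[x:=v]$ = capture-avoiding substitution. $\mapsto$ is the least relation with $(\lambda x\leq t.u)\,v\mapsto u[x:=v]$ closed under all term contexts (if $t\mapsto t'$ then $\lambda x\leq t.u\mapsto\lambda x\leq t'.u$, $\lambda x\leq u.t\mapsto\lambda x\leq u.t'$, $t\,u\mapsto t'\,u$, $u\,t\mapsto u\,t'$). Extended context $\Gamma;s$: a finite sequence $\Gamma$ of annotations $x\leq t$ and a finite list (stack) $s$ of terms; $\varepsilon;[]$ empty, $\Gamma,x\leq t;s$ appends an annotation, $\Gamma;\alpha::s$ pushes $\alpha$. $\mathrm{dom}(\Gamma)$ = annotated variables; $x\leq t\in\Gamma$ means the annotation occurs in $\Gamma$; "$x$ has subtype $t$ in $\Gamma$" means $x\leq t$ is the last annotation for $x$ in $\Gamma$. Prevalidity: least predicate with $\varepsilon;[]$ prevalid; $\Gamma,x\leq t;[]$ prevalid if $\Gamma;[]$ prevalid, $x\notin\mathrm{dom}(\Gamma)$, $\mathrm{fv}(t)\subseteq\mathrm{dom}(\Gamma)$; $\Gamma;\alpha::s$ prevalid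 if $\Gamma;s$ prevalid and $\mathrm{fv}(\alpha)\subseteq\mathrm{dom}(\Gamma)$. Equivalence reduction $\to_{\equiv}$: least relation with $x\to_{\equiv}x$; $\top\to_{\equiv}\top$; $\top\,u\to_{\equiv}\top$; if $u\to_{\equiv}u'$, $v\to_{\equiv}v'$ then $u\,v\to_{\equiv}u'\,v'$ and $(\lambda x\leq t.u)\,v\to_{\equiv}u'[x:=v']$; if $t\to_{\equiv}t'$, $u\to_{\equiv}u'$ then $\lambda x\leq t.u\to_{\equiv}\lambda x\leq t'.u'$. Subtyping reduction $\Gamma;s\vdash u\to_{\leq}v$: least relation with (Prom) $\Gamma;s$ prevalid and $x\leq t\in\Gamma$ give $\Gamma;s\vdash x\to_{\leq}t$; (Top) $\Gamma;s$ prevalid gives $\Gamma;s\vdash u\to_{\leq}\top$; (Eq) $\Gamma;s$ prevalid and $u\to_{\equiv}v$ give $\Gamma;s\vdash u\to_{\leq}v$; (App) $\Gamma;v::s\vdash u\to_{\leq}u'$ gives $\Gamma;s\vdash u\,v\to_{\leq}u'\,v$; (FunOp) $\Gamma,x\leq\alpha;s\vdash u\to_{\leq}u'$ gives $\Gamma;\alpha::s\vdash\lambda x\leq t.u\to_{\leq}\lambda x\leq t.u'$; (Fun) $\Gamma,x\leq t;[]\vdash u\to_{\leq}u'$ gives $\Gamma;[]\vdash\lambda x\leq t.u\to_{\leq}\lambda x\leq t.u'$. Subtyping: $\Gamma;s\vdash v\leq t$ is the least relation with: if $\Gamma;s$ prevalid then $\Gamma;s\vdash t\leq t$; if $\Gamma;s\vdash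 v\to_{\leq}v'$ and $\Gamma;s\vdash v'\leq t$ then $\Gamma;s\vdash v\leq t$; if $\Gamma;s\vdash v\leq t'$ and $t\to_{\equiv}t'$ then $\Gamma;s\vdash v\leq t$. Well-formedness $\Gamma;s\vdash t\ \mathrm{wf}$, well-subtyping $\leq_{\mathrm{wf}}$ and transitive well-subtyping $\leq^*_{\mathrm{wf}}$ are the least relations (defined simultaneously) with: (W-Var) if $\Gamma;s$ prevalid, $x$ has subtype $t$ in $\Gamma$ and $\Gamma;s\vdash t\ \mathrm{wf}$ then $\Gamma;s\vdash x\ \mathrm{wf}$; (W-Top) if $\Gamma;s$ prevalid then $\Gamma;s\vdash\top\ \mathrm{wf}$; (W-Fun) if $\Gamma,x\leq t;[]\vdash u\ \mathrm{wf}$ and $\Gamma;[]\vdash t\ \mathrm{wf}$ then $\Gamma;[]\vdash\lambda x\leq t.u\ \mathrm{wf}$; (W-FunOp) if $\Gamma,x\leq\delta;s\vdash u\ \mathrm{wf}$ and $\Gamma;[]\vdash t\ \mathrm{wf}$ then $\Gamma;\delta::s\vdash\lambda x\leq t.u\ \mathrm{wf}$; (W-App) if $\Gamma;v::s\vdash u\leq^*_{\mathrm{wf}}\lambda x\leq t.\top$ and $\Gamma;[]\vdash v\leq^*_{\mathrm{wf}}t$ then $\Gamma;s\vdash u\,v\ \mathrm{wf}$; (Wf-Rule) if $\Gamma;s\vdash u\ \mathrm{wf}$, $\Gamma;s\vdash t\ \mathrm{wf}$ and $\Gamma;s\vdash u\leq t$ then $\Gamma;s\vdash u\leq_{\mathrm{wf}}t$;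 (Wf-Sub) $\Gamma;s\vdash v\leq_{\mathrm{wf}}t$ gives $\Gamma;s\vdash v\leq^*_{\mathrm{wf}}t$; (Wf-Trans) if $\Gamma;s\vdash v\leq^*_{\mathrm{wf}}u$, $\Gamma;s\vdash u\leq^*_{\mathrm{wf}}t$ and $\Gamma;s\vdash u\ \mathrm{wf}$ then $\Gamma;s\vdash v\leq^*_{\mathrm{wf}}t$. -}

module Defs where

open import Data.Nat using (ℕ; zero; suc; _<_; _∸_)
open import Data.Nat using (_<ᵇ_; _≡ᵇ_)
open import Data.Bool using (if_then_else_)
open import Data.List using (List; []; _∷_; length; map)

-- Terms up to α-equivalence, represented with de Bruijn indices:
-- var k, ⊤, lam t u  (= λ x ≤ t . u, u is under the binder), app u v.
data Term : Set where
  var : ℕ → Term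
  top : Term
  lam : Term → Term → Term
  app : Term → Term → Term

shift : ℕ → Term → Term
shift c (var k)   = if k <ᵇ c then var k else var (suc k)
shift c top       = top
shift c (lam t u) = lam (shift c t) (shift (suc c) u)
shift c (app u v) = app (shift c u) (shift c v)

↑ : Term → Term
↑ = shift 0

shiftN : ℕ → Term → Term
shiftN zero    t = t
shiftN (suc n) t = ↑ (shiftN n t)

-- substTop j v u : capture-avoiding substitution of v (scoped outside the j
-- binders) for index j in u, lowering the indices above j
substAt : ℕ → Term → Term → Term
substAt j v (var k)   =
  if k <ᵇ j then var k else (if k ≡ᵇ j then shiftN j v else var (k ∸ 1))
substAt j v top       = top
substAt j v (lam t u) = lam (substAt j v t) (substAt (suc j) v u)
substAt j v (app u w) = app (substAt j v u) (substAt j v w)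

-- u [ x := v ] where x is the outermost bound variable of u
_[0:=_] : Term → Term → Term
u [0:= v ] = substAt 0 v u

data Scoped : ℕ → Term → Set where
  sc-var : ∀ {n k} → k < n → Scoped n (var k)
  sc-top : ∀ {n} → Scoped n top
  sc-lam : ∀ {n t u} → Scoped n t → Scoped (suc n) u → Scoped n (lam t u)
  sc-app : ∀ {n u v} → Scoped n u → Scoped n v → Scoped n (app u v)

infix 4 _↦_
data _↦_ : Term → Term → Set where
  β     : ∀ {t u v} → app (lam t u) v ↦ u [0:= v ]
  lamL  : ∀ {t t' u} → t ↦ t' → lam t u ↦ lam t' u
  lamR  : ∀ {t u u'} → u ↦ u' → lam t u ↦ lam t u'
  appL  : ∀ {t t' u} → t ↦ t' → app t u ↦ app t' u
  appR  : ∀ {t t' u} → t ↦ t' → app u t ↦ app u t'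

-- Contexts: Γ , x ≤ t is  t ∷ Γ  (the head is de Bruijn index 0);
-- the annotation t is scoped over the rest of the context.
Ctx : Set
Ctx = List Term

-- Stacks: terms scoped over the current context; α :: s is α ∷ s.
Stack : Set
Stack = List Term

-- Γ ∋ k ≤ t : variable k has subtype t in Γ (t weakened to the scope of Γ)
data _∋_≤_ : Ctx → ℕ → Term → Set where
  here  : ∀ {Γ t} → (t ∷ Γ) ∋ 0 ≤ ↑ t
  there : ∀ {Γ a k t} → Γ ∋ k ≤ t → (a ∷ Γ) ∋ suc k ≤ ↑ t

data Prevalid : Ctx → Stack → Set where
  pv-empty : Prevalid [] []
  pv-ext   : ∀ {Γ t} → Prevalid Γ [] → Scoped (length Γ) t → Prevalid (t ∷ Γ) []
  pv-push  : ∀ {Γ s α} → Prevalid Γ s → Scoped (length Γ) α → Prevalid Γ (α ∷ s)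

infix 4 _→≡_
data _→≡_ : Term → Term → Set where
  eq-var : ∀ {x} → var x →≡ var x
  eq-top : top →≡ top
  eq-topApp : ∀ {u} → app top u →≡ top
  eq-app : ∀ {u u' v v'} → u →≡ u' → v →≡ v' → app u v →≡ app u' v'
  eq-β   : ∀ {t u u' v v'} → u →≡ u' → v →≡ v' → app (lam t u) v →≡ u' [0:= v' ]
  eq-lam : ∀ {t t' u u'} → t →≡ t' → u →≡ u' → lam t u →≡ lam t' u'

data _︔_⊢_→≤_ : Ctx → Stack → Term → Term → Set where
  r-prom  : ∀ {Γ s x t} → Prevalid Γ s → Γ ∋ x ≤ t → Γ ︔ s ⊢ var x →≤ t
  r-top   : ∀ {Γ s u} → Prevalid Γ s → Γ ︔ s ⊢ u →≤ top
  r-eq    : ∀ {Γ s u v} → Prevalid Γ s → u →≡ v → Γ ︔ s ⊢ u →≤ v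
  r-app   : ∀ {Γ s u u' v} → Γ ︔ (v ∷ s) ⊢ u →≤ u' → Γ ︔ s ⊢ app u v →≤ app u' v
  r-funop : ∀ {Γ s α t u u'} → (α ∷ Γ) ︔ map ↑ s ⊢ u →≤ u' →
            Γ ︔ (α ∷ s) ⊢ lam t u →≤ lam t u'
  r-fun   : ∀ {Γ t u u'} → (t ∷ Γ) ︔ [] ⊢ u →≤ u' → Γ ︔ [] ⊢ lam t u →≤ lam t u'

data _︔_⊢_≤_ : Ctx → Stack → Term → Term → Set where
  s-refl : ∀ {Γ s t} → Prevalid Γ s → Γ ︔ s ⊢ t ≤ t
  s-step : ∀ {Γ s v v' t} → Γ ︔ s ⊢ v →≤ v' → Γ ︔ s ⊢ v' ≤ t → Γ ︔ s ⊢ v ≤ t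
  s-eq   : ∀ {Γ s v t t'} → Γ ︔ s ⊢ v ≤ t' → t →≡ t' → Γ ︔ s ⊢ v ≤ t

data _︔_⊢_wf : Ctx → Stack → Term → Set
data _︔_⊢_≤wf_ : Ctx → Stack → Term → Term → Set
data _︔_⊢_≤*wf_ : Ctx → Stack → Term → Term → Set

data _︔_⊢_wf where
  w-var   : ∀ {Γ s x t} → Prevalid Γ s → Γ ∋ x ≤ t → Γ ︔ s ⊢ t wf → Γ ︔ s ⊢ var x wf
  w-top   : ∀ {Γ s} → Prevalid Γ s → Γ ︔ s ⊢ top wf
  w-fun   : ∀ {Γ t u} → (t ∷ Γ) ︔ [] ⊢ u wf → Γ ︔ [] ⊢ t wf → Γ ︔ [] ⊢ lam t u wf
  w-funop : ∀ {Γ s δ t u} → (δ ∷ Γ) ︔ map ↑ s ⊢ u wf → Γ ︔ [] ⊢ t wf →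
            Γ ︔ (δ ∷ s) ⊢ lam t u wf
  w-app   : ∀ {Γ s u v t} → Γ ︔ (v ∷ s) ⊢ u ≤*wf lam t top → Γ ︔ [] ⊢ v ≤*wf t →
            Γ ︔ s ⊢ app u v wf

data _︔_⊢_≤wf_ where
  wf-rule : ∀ {Γ s u t} → Γ ︔ s ⊢ u wf → Γ ︔ s ⊢ t wf → Γ ︔ s ⊢ u ≤ t → Γ ︔ s ⊢ u ≤wf t

data _︔_⊢_≤*wf_ where
  wf-sub   : ∀ {Γ s v t} → Γ ︔ s ⊢ v ≤wf t → Γ ︔ s ⊢ v ≤*wf t
  wf-trans : ∀ {Γ s v u t} → Γ ︔ s ⊢ v ≤*wf u → Γ ︔ s ⊢ u ≤*wf t → Γ ︔ s ⊢ u wf →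
             Γ ︔ s ⊢ v ≤*wf t

-- A β-step is an instance of the parallel reduction →≡, so it suffices to
-- show that wf and ≤*wf are stable under →≡ applied simultaneously to the
-- context, the stack and both sides of a judgement.  Three facts carry this.
-- (1) →≡ has the triangle property with respect to complete development,
-- hence is confluent.  (2) A subtyping-reduction step commutes with →≡, so
-- by (1) the relation ≤ is stable too.  (3) A β-redex is well-formed, or
-- takes FunOp steps, only through W-FunOp / FunOp, where the bound variable
-- is annotated with the argument itself; replacing that variable by the
-- argument maps every annotation to its own instance, so this substitution
-- preserves all judgements.

module Submission where

open import Data.Bool using (true; false; if_then_else_)
open import Data.List using (List; []; _∷_; length; map)
open import Data.List.Properties using (map-∘; map-cong; map-id)
open import Data.List.Relation.Binary.Pointwise as Pointwise
  using (Pointwise; []; _∷_; Pointwise-length; map⁺)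
open import Data.Nat using (ℕ; zero; suc; _<_; _∸_; _<ᵇ_; _≡ᵇ_; z≤n; s≤s)
open import Data.Product using (∃; _×_; _,_)
open import Data.Sum using (_⊎_; inj₁; inj₂)
open import Function using (_∘_)
open import Relation.Binary.Construct.Closure.ReflexiveTransitive
  using (Star; ε; _◅_; _◅◅_; gmap)
open import Relation.Binary.PropositionalEquality
  using (_≡_; refl; sym; trans; cong; cong₂; subst; subst₂)

open import Defs

-- Renaming and simultaneous substitution

ext : (ℕ → ℕ) → ℕ → ℕ
ext ρ zero    = zero
ext ρ (suc k) = suc (ρ k)

rename : (ℕ → ℕ) → Term → Term
rename ρ (var k)   = var (ρ k)
rename ρ top       = top
rename ρ (lam t u) = lam (rename ρ t) (rename (ext ρ) u)
rename ρ (app u v) = app (rename ρ u) (rename ρ v)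

exts : (ℕ → Term) → ℕ → Term
exts σ zero    = var zero
exts σ (suc k) = rename suc (σ k)

sub : (ℕ → Term) → Term → Term
sub σ (var k)   = σ k
sub σ top       = top
sub σ (lam t u) = lam (sub σ t) (sub (exts σ) u)
sub σ (app u v) = app (sub σ u) (sub σ v)

σ₀ : Term → ℕ → Term
σ₀ v zero    = v
σ₀ v (suc k) = var k

rename-cong : ∀ {ρ ρ'} → (∀ x → ρ x ≡ ρ' x) → ∀ t → rename ρ t ≡ rename ρ' t
rename-cong h (var k)   = cong var (h k)
rename-cong h top       = refl
rename-cong h (lam t u) = cong₂ lam (rename-cong h t) (rename-cong h' u)
  where
  h' : ∀ x → ext _ x ≡ ext _ x
  h' zero    = refl
  h' (suc x) = cong suc (h x)
rename-cong h (app u v) = cong₂ app (rename-cong h u) (rename-cong h v)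

sub-cong : ∀ {σ σ'} → (∀ x → σ x ≡ σ' x) → ∀ t → sub σ t ≡ sub σ' t
sub-cong h (var k)   = h k
sub-cong h top       = refl
sub-cong h (lam t u) = cong₂ lam (sub-cong h t) (sub-cong h' u)
  where
  h' : ∀ x → exts _ x ≡ exts _ x
  h' zero    = refl
  h' (suc x) = cong (rename suc) (h x)
sub-cong h (app u v) = cong₂ app (sub-cong h u) (sub-cong h v)

rename-rename : ∀ ρ ρ' t → rename ρ (rename ρ' t) ≡ rename (ρ ∘ ρ') t
rename-rename ρ ρ' (var k)   = refl
rename-rename ρ ρ' top       = refl
rename-rename ρ ρ' (lam t u) =
  cong₂ lam (rename-rename ρ ρ' t)
            (trans (rename-rename (ext ρ) (ext ρ') u) (rename-cong h u))
  where
  h : ∀ x → ext ρ (ext ρ' x) ≡ ext (ρ ∘ ρ') x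
  h zero    = refl
  h (suc x) = refl
rename-rename ρ ρ' (app u v) = cong₂ app (rename-rename ρ ρ' u) (rename-rename ρ ρ' v)

sub-rename : ∀ σ ρ t → sub σ (rename ρ t) ≡ sub (σ ∘ ρ) t
sub-rename σ ρ (var k)   = refl
sub-rename σ ρ top       = refl
sub-rename σ ρ (lam t u) =
  cong₂ lam (sub-rename σ ρ t)
            (trans (sub-rename (exts σ) (ext ρ) u) (sub-cong h u))
  where
  h : ∀ x → exts σ (ext ρ x) ≡ exts (σ ∘ ρ) x
  h zero    = refl
  h (suc x) = refl
sub-rename σ ρ (app u v) = cong₂ app (sub-rename σ ρ u) (sub-rename σ ρ v)

rename-sub : ∀ ρ σ t → rename ρ (sub σ t) ≡ sub (rename ρ ∘ σ) t
rename-sub ρ σ (var k)   = refl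
rename-sub ρ σ top       = refl
rename-sub ρ σ (lam t u) =
  cong₂ lam (rename-sub ρ σ t)
            (trans (rename-sub (ext ρ) (exts σ) u) (sub-cong h u))
  where
  h : ∀ x → rename (ext ρ) (exts σ x) ≡ exts (rename ρ ∘ σ) x
  h zero    = refl
  h (suc x) = trans (rename-rename (ext ρ) suc (σ x)) (sym (rename-rename suc ρ (σ x)))
rename-sub ρ σ (app u v) = cong₂ app (rename-sub ρ σ u) (rename-sub ρ σ v)

sub-sub : ∀ σ τ t → sub σ (sub τ t) ≡ sub (sub σ ∘ τ) t
sub-sub σ τ (var k)   = refl
sub-sub σ τ top       = refl
sub-sub σ τ (lam t u) =
  cong₂ lam (sub-sub σ τ t)
            (trans (sub-sub (exts σ) (exts τ) u) (sub-cong h u))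
  where
  h : ∀ x → sub (exts σ) (exts τ x) ≡ exts (sub σ ∘ τ) x
  h zero    = refl
  h (suc x) = trans (sub-rename (exts σ) suc (τ x)) (sym (rename-sub suc σ (τ x)))
sub-sub σ τ (app u v) = cong₂ app (sub-sub σ τ u) (sub-sub σ τ v)

sub-var : ∀ t → sub var t ≡ t
sub-var (var k)   = refl
sub-var top       = refl
sub-var (lam t u) = cong₂ lam (sub-var t) (trans (sub-cong h u) (sub-var u))
  where
  h : ∀ x → exts var x ≡ var x
  h zero    = refl
  h (suc x) = refl
sub-var (app u v) = cong₂ app (sub-var u) (sub-var v)

sub-exts-weaken : ∀ σ t → sub (exts σ) (rename suc t) ≡ rename suc (sub σ t)
sub-exts-weaken σ t = trans (sub-rename (exts σ) suc t) (sym (rename-sub suc σ t))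

sub-σ₀-weaken : ∀ v t → sub (σ₀ v) (rename suc t) ≡ t
sub-σ₀-weaken v t = trans (sub-rename (σ₀ v) suc t) (sub-var t)

sub-σ₀-commute : ∀ σ u v → sub σ (sub (σ₀ v) u) ≡ sub (σ₀ (sub σ v)) (sub (exts σ) u)
sub-σ₀-commute σ u v =
  trans (sub-sub σ (σ₀ v) u)
        (trans (sub-cong h u) (sym (sub-sub (σ₀ (sub σ v)) (exts σ) u)))
  where
  h : ∀ x → sub σ (σ₀ v x) ≡ sub (σ₀ (sub σ v)) (exts σ x)
  h zero    = refl
  h (suc x) = sym (sub-σ₀-weaken (sub σ v) (σ x))

rename-σ₀-commute : ∀ ρ u v → rename ρ (sub (σ₀ v) u) ≡ sub (σ₀ (rename ρ v)) (rename (ext ρ) u)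
rename-σ₀-commute ρ u v =
  trans (rename-sub ρ (σ₀ v) u)
        (trans (sub-cong h u) (sym (sub-rename (σ₀ (rename ρ v)) (ext ρ) u)))
  where
  h : ∀ x → rename ρ (σ₀ v x) ≡ σ₀ (rename ρ v) (ext ρ x)
  h zero    = refl
  h (suc x) = refl

-- shift and substAt as renaming and substitution

shiftVar : ℕ → ℕ → ℕ
shiftVar c k = if k <ᵇ c then k else suc k

shift-rename : ∀ c t → shift c t ≡ rename (shiftVar c) t
shift-rename c (var k) with k <ᵇ c
... | true  = refl
... | false = refl
shift-rename c top       = refl
shift-rename c (lam t u) =
  cong₂ lam (shift-rename c t) (trans (shift-rename (suc c) u) (rename-cong h u))
  where
  h : ∀ x → shiftVar (suc c) x ≡ ext (shiftVar c) x
  h zero = refl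
  h (suc x) with x <ᵇ c
  ... | true  = refl
  ... | false = refl
shift-rename c (app u v) = cong₂ app (shift-rename c u) (shift-rename c v)

↑-rename : ∀ t → ↑ t ≡ rename suc t
↑-rename t = trans (shift-rename 0 t) (rename-cong (λ _ → refl) t)

substAt-σ : ℕ → Term → ℕ → Term
substAt-σ j v k = if k <ᵇ j then var k else (if k ≡ᵇ j then shiftN j v else var (k ∸ 1))

substAt-σ-suc : ∀ j v x → substAt-σ (suc j) v x ≡ exts (substAt-σ j v) x
substAt-σ-suc j       v zero          = refl
substAt-σ-suc zero    v (suc zero)    = ↑-rename v
substAt-σ-suc zero    v (suc (suc k)) = refl
substAt-σ-suc (suc j) v (suc zero)    = refl
substAt-σ-suc (suc j) v (suc (suc k)) with suc k <ᵇ suc j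
... | true = refl
... | false with suc k ≡ᵇ suc j
...   | true  = ↑-rename (shiftN (suc j) v)
...   | false = refl

substAt-sub : ∀ j v t → substAt j v t ≡ sub (substAt-σ j v) t
substAt-sub j v (var k)   = refl
substAt-sub j v top       = refl
substAt-sub j v (lam t u) =
  cong₂ lam (substAt-sub j v t) (trans (substAt-sub (suc j) v u) (sub-cong (substAt-σ-suc j v) u))
substAt-sub j v (app u w) = cong₂ app (substAt-sub j v u) (substAt-sub j v w)

[0:=]-sub : ∀ u v → u [0:= v ] ≡ sub (σ₀ v) u
[0:=]-sub u v = trans (substAt-sub 0 v u) (sub-cong h u)
  where
  h : ∀ x → substAt-σ 0 v x ≡ σ₀ v x
  h zero    = refl
  h (suc x) = refl

sub-exts-↑ : ∀ σ a → sub (exts σ) (↑ a) ≡ ↑ (sub σ a)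
sub-exts-↑ σ a =
  trans (cong (sub (exts σ)) (↑-rename a)) (trans (sub-exts-weaken σ a) (sym (↑-rename (sub σ a))))

sub-σ₀-↑ : ∀ v a → sub (σ₀ v) (↑ a) ≡ a
sub-σ₀-↑ v a = trans (cong (sub (σ₀ v)) (↑-rename a)) (sub-σ₀-weaken v a)

map-sub-exts-↑ : ∀ σ s → map (sub (exts σ)) (map ↑ s) ≡ map ↑ (map (sub σ) s)
map-sub-exts-↑ σ s = trans (sym (map-∘ s)) (trans (map-cong (sub-exts-↑ σ) s) (map-∘ s))

map-sub-σ₀-↑ : ∀ v s → map (sub (σ₀ v)) (map ↑ s) ≡ s
map-sub-σ₀-↑ v s = trans (sym (map-∘ s)) (trans (map-cong (sub-σ₀-↑ v) s) (map-id s))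

-- Equivalence reduction is a parallel reduction

→≡-refl : ∀ t → t →≡ t
→≡-refl (var x)   = eq-var
→≡-refl top       = eq-top
→≡-refl (lam t u) = eq-lam (→≡-refl t) (→≡-refl u)
→≡-refl (app u v) = eq-app (→≡-refl u) (→≡-refl v)

→≡-β : ∀ {t u u' v v'} → u →≡ u' → v →≡ v' → app (lam t u) v →≡ sub (σ₀ v') u'
→≡-β {u' = u'} {v' = v'} p q = subst (_ →≡_) ([0:=]-sub u' v') (eq-β p q)

→≡-rename : ∀ ρ {u u'} → u →≡ u' → rename ρ u →≡ rename ρ u'
→≡-rename ρ eq-var       = eq-var
→≡-rename ρ eq-top       = eq-top
→≡-rename ρ eq-topApp    = eq-topApp
→≡-rename ρ (eq-app p q) = eq-app (→≡-rename ρ p) (→≡-rename ρ q)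
→≡-rename ρ (eq-β {u' = u'} {v' = v'} p q) =
  subst (_ →≡_) (sym (trans (cong (rename ρ) ([0:=]-sub u' v')) (rename-σ₀-commute ρ u' v')))
    (→≡-β (→≡-rename (ext ρ) p) (→≡-rename ρ q))
→≡-rename ρ (eq-lam p q) = eq-lam (→≡-rename ρ p) (→≡-rename (ext ρ) q)

→≡-↑ : ∀ {u u'} → u →≡ u' → ↑ u →≡ ↑ u'
→≡-↑ {u} {u'} p = subst₂ _→≡_ (sym (↑-rename u)) (sym (↑-rename u')) (→≡-rename suc p)

→≡-exts : ∀ {σ σ'} → (∀ x → σ x →≡ σ' x) → ∀ x → exts σ x →≡ exts σ' x
→≡-exts h zero    = eq-var
→≡-exts h (suc x) = →≡-rename suc (h x)

→≡-sub : ∀ {σ σ'} → (∀ x → σ x →≡ σ' x) → ∀ {u u'} → u →≡ u' → sub σ u →≡ sub σ' u'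
→≡-sub h (eq-var {x})  = h x
→≡-sub h eq-top        = eq-top
→≡-sub h eq-topApp     = eq-topApp
→≡-sub h (eq-app p q)  = eq-app (→≡-sub h p) (→≡-sub h q)
→≡-sub {σ' = σ'} h (eq-β {u' = u'} {v' = v'} p q) =
  subst (_ →≡_) (sym (trans (cong (sub σ') ([0:=]-sub u' v')) (sub-σ₀-commute σ' u' v')))
    (→≡-β (→≡-sub (→≡-exts h) p) (→≡-sub h q))
→≡-sub h (eq-lam p q)  = eq-lam (→≡-sub h p) (→≡-sub (→≡-exts h) q)

→≡-sub-σ₀ : ∀ {u u' v v'} → u →≡ u' → v →≡ v' → sub (σ₀ v) u →≡ sub (σ₀ v') u'
→≡-sub-σ₀ {v = v} {v'} p q = →≡-sub h p
  where
  h : ∀ x → σ₀ v x →≡ σ₀ v' x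
  h zero    = q
  h (suc x) = eq-var

develop : Term → Term
develop (var x)           = var x
develop top               = top
develop (lam t u)         = lam (develop t) (develop u)
develop (app top v)       = top
develop (app (lam t u) v) = sub (σ₀ (develop v)) (develop u)
develop (app (var x) v)   = app (var x) (develop v)
develop (app (app a b) v) = app (develop (app a b)) (develop v)

→≡-develop : ∀ {u u'} → u →≡ u' → u' →≡ develop u
→≡-develop eq-var    = eq-var
→≡-develop eq-top    = eq-top
→≡-develop eq-topApp = eq-top
→≡-develop (eq-app {u = var x} p q)               = eq-app (→≡-develop p) (→≡-develop q)
→≡-develop (eq-app {u = top} eq-top q)            = eq-topApp
→≡-develop (eq-app {u = lam t b} (eq-lam _ p) q)  = →≡-β (→≡-develop p) (→≡-develop q)
→≡-develop (eq-app {u = app a b} p q)             = eq-app (→≡-develop p) (→≡-develop q)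
→≡-develop (eq-β {u' = u'} {v' = v'} p q) =
  subst (_→≡ _) (sym ([0:=]-sub u' v')) (→≡-sub-σ₀ (→≡-develop p) (→≡-develop q))
→≡-develop (eq-lam p q) = eq-lam (→≡-develop p) (→≡-develop q)

_→≡*_ : Term → Term → Set
_→≡*_ = Star _→≡_

→≡-strip : ∀ {a b c} → a →≡ b → a →≡* c → ∃ λ d → b →≡* d × c →≡ d
→≡-strip {b = b} p ε = b , ε , p
→≡-strip p (q ◅ qs) with →≡-strip (→≡-develop q) qs
... | d , bs , r = d , →≡-develop p ◅ bs , r

-- Scoping and prevalidity

rename-Scoped : ∀ {n m ρ t} → Scoped n t → (∀ {x} → x < n → ρ x < m) → Scoped m (rename ρ t)
rename-Scoped (sc-var k<n) h = sc-var (h k<n)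
rename-Scoped sc-top       h = sc-top
rename-Scoped (sc-lam a b) h = sc-lam (rename-Scoped a h) (rename-Scoped b h')
  where
  h' : ∀ {x} → x < suc _ → ext _ x < suc _
  h' {zero}  _       = s≤s z≤n
  h' {suc x} (s≤s p) = s≤s (h p)
rename-Scoped (sc-app a b) h = sc-app (rename-Scoped a h) (rename-Scoped b h)

sub-Scoped : ∀ {n m σ t} → Scoped n t → (∀ {x} → x < n → Scoped m (σ x)) → Scoped m (sub σ t)
sub-Scoped (sc-var k<n) h = h k<n
sub-Scoped sc-top       h = sc-top
sub-Scoped (sc-lam a b) h = sc-lam (sub-Scoped a h) (sub-Scoped b h')
  where
  h' : ∀ {x} → x < suc _ → Scoped (suc _) (exts _ x)
  h' {zero}  _       = sc-var (s≤s z≤n)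
  h' {suc x} (s≤s p) = rename-Scoped (h p) s≤s
sub-Scoped (sc-app a b) h = sc-app (sub-Scoped a h) (sub-Scoped b h)

σ₀-Scoped : ∀ {n v} → Scoped n v → ∀ {x} → x < suc n → Scoped n (σ₀ v x)
σ₀-Scoped v-sc {zero}  _       = v-sc
σ₀-Scoped v-sc {suc x} (s≤s p) = sc-var p

→≡-Scoped : ∀ {n u u'} → Scoped n u → u →≡ u' → Scoped n u'
→≡-Scoped a eq-var    = a
→≡-Scoped a eq-top    = a
→≡-Scoped a eq-topApp = sc-top
→≡-Scoped (sc-app a b) (eq-app p q) = sc-app (→≡-Scoped a p) (→≡-Scoped b q)
→≡-Scoped (sc-app (sc-lam _ b) c) (eq-β {u' = u'} {v' = v'} p q) =
  subst (Scoped _) (sym ([0:=]-sub u' v')) (sub-Scoped (→≡-Scoped b p) (σ₀-Scoped (→≡-Scoped c q)))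
→≡-Scoped (sc-lam a b) (eq-lam p q) = sc-lam (→≡-Scoped a p) (→≡-Scoped b q)

infix 4 _⇛_
_⇛_ : List Term → List Term → Set
_⇛_ = Pointwise _→≡_

⇛-refl : ∀ l → l ⇛ l
⇛-refl l = Pointwise.refl (λ {t} → →≡-refl t)

⇛-map-↑ : ∀ {l l'} → l ⇛ l' → map ↑ l ⇛ map ↑ l'
⇛-map-↑ rl = map⁺ ↑ ↑ (Pointwise.map →≡-↑ rl)

Prevalid-⇛ : ∀ {Γ Γ' s s'} → Γ ⇛ Γ' → s ⇛ s' → Prevalid Γ s → Prevalid Γ' s'
Prevalid-⇛ []       []       pv-empty       = pv-empty
Prevalid-⇛ (e ∷ rΓ) []       (pv-ext p a)  =
  pv-ext (Prevalid-⇛ rΓ [] p) (subst (λ n → Scoped n _) (Pointwise-length rΓ) (→≡-Scoped a e))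
Prevalid-⇛ rΓ       (e ∷ rs) (pv-push p a) =
  pv-push (Prevalid-⇛ rΓ rs p) (subst (λ n → Scoped n _) (Pointwise-length rΓ) (→≡-Scoped a e))

∋-⇛ : ∀ {Γ Γ' x B} → Γ ⇛ Γ' → Γ ∋ x ≤ B → ∃ λ B' → Γ' ∋ x ≤ B' × B →≡ B'
∋-⇛ (e ∷ rΓ) here      = _ , here , →≡-↑ e
∋-⇛ (e ∷ rΓ) (there p) with ∋-⇛ rΓ p
... | B' , p' , e' = ↑ B' , there p' , →≡-↑ e'

Prevalid-pop : ∀ {Γ a s} → Prevalid Γ (a ∷ s) → Prevalid Γ s
Prevalid-pop (pv-push p _) = p

Prevalid-clear : ∀ {Γ s} → Prevalid Γ s → Prevalid Γ []
Prevalid-clear pv-empty      = pv-empty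
Prevalid-clear (pv-ext p a)  = pv-ext p a
Prevalid-clear (pv-push p _) = Prevalid-clear p

Prevalid-tail : ∀ {Γ a} → Prevalid (a ∷ Γ) [] → Prevalid Γ []
Prevalid-tail (pv-ext p _) = p

Prevalid-head : ∀ {Γ a} → Prevalid (a ∷ Γ) [] → Scoped (length Γ) a
Prevalid-head (pv-ext _ a) = a

→≤-Prevalid : ∀ {Γ s u w} → Γ ︔ s ⊢ u →≤ w → Prevalid Γ []
→≤-Prevalid (r-prom p _) = Prevalid-clear p
→≤-Prevalid (r-top p)    = Prevalid-clear p
→≤-Prevalid (r-eq p _)   = Prevalid-clear p
→≤-Prevalid (r-app d)    = →≤-Prevalid d
→≤-Prevalid (r-funop d)  = Prevalid-tail (→≤-Prevalid d)
→≤-Prevalid (r-fun d)    = Prevalid-tail (→≤-Prevalid d)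

≤-Prevalid : ∀ {Γ s u t} → Γ ︔ s ⊢ u ≤ t → Prevalid Γ s
≤-Prevalid (s-refl p)   = p
≤-Prevalid (s-step _ l) = ≤-Prevalid l
≤-Prevalid (s-eq l _)   = ≤-Prevalid l

≤*wf-Prevalid : ∀ {Γ s u t} → Γ ︔ s ⊢ u ≤*wf t → Prevalid Γ s
≤*wf-Prevalid (wf-sub (wf-rule _ _ l)) = ≤-Prevalid l
≤*wf-Prevalid (wf-trans c _ _)         = ≤*wf-Prevalid c

wf-Prevalid : ∀ {Γ s t} → Γ ︔ s ⊢ t wf → Prevalid Γ []
wf-Prevalid (w-var p _ _)  = Prevalid-clear p
wf-Prevalid (w-top p)      = Prevalid-clear p
wf-Prevalid (w-fun _ Dt)   = wf-Prevalid Dt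
wf-Prevalid (w-funop _ Dt) = wf-Prevalid Dt
wf-Prevalid (w-app c _)    = Prevalid-clear (≤*wf-Prevalid c)

-- Besides renamings, this admits replacing a variable by the instance of its
-- own annotation, as a FunOp-redex does.
record WellSubst (σ : ℕ → Term) (Γ Γ' : Ctx) : Set where
  field
    bound    : ∀ {x B} → Γ ∋ x ≤ B →
               σ x ≡ sub σ B ⊎ ∃ λ y → σ x ≡ var y × Γ' ∋ y ≤ sub σ B
    scoped   : ∀ {x} → x < length Γ → Scoped (length Γ') (σ x)
    prevalid : Prevalid Γ' []
open WellSubst

sub-Prevalid : ∀ {σ Γ Γ' s} → WellSubst σ Γ Γ' → Prevalid Γ s → Prevalid Γ' (map (sub σ) s)
sub-Prevalid {s = []}    ok _             = prevalid ok
sub-Prevalid {s = _ ∷ _} ok (pv-push p a) = pv-push (sub-Prevalid ok p) (sub-Scoped a (scoped ok))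

WellSubst-exts : ∀ {σ Γ Γ' a} → WellSubst σ Γ Γ' → Prevalid (a ∷ Γ) [] →
                 WellSubst (exts σ) (a ∷ Γ) (sub σ a ∷ Γ')
bound (WellSubst-exts {σ} {Γ' = Γ'} {a = a} ok p) here =
  inj₂ (zero , refl , subst ((sub σ a ∷ Γ') ∋ zero ≤_) (sym (sub-exts-↑ σ a)) here)
bound (WellSubst-exts {σ} ok p) (there {t = B} q) with bound ok q
... | inj₁ e =
  inj₁ (trans (cong (rename suc) e) (trans (sym (↑-rename (sub σ B))) (sym (sub-exts-↑ σ B))))
... | inj₂ (y , e , q') =
  inj₂ (suc y , cong (rename suc) e , subst (_ ∋ suc y ≤_) (sym (sub-exts-↑ σ B)) (there q'))
scoped   (WellSubst-exts ok p) {zero}  _       = sc-var (s≤s z≤n)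
scoped   (WellSubst-exts ok p) {suc x} (s≤s q) = rename-Scoped (scoped ok q) s≤s
prevalid (WellSubst-exts ok p) = pv-ext (prevalid ok) (sub-Scoped (Prevalid-head p) (scoped ok))

WellSubst-σ₀ : ∀ {v Γ} → Prevalid (v ∷ Γ) [] → WellSubst (σ₀ v) (v ∷ Γ) Γ
bound    (WellSubst-σ₀ {v} p) here = inj₁ (sym (sub-σ₀-↑ v v))
bound    (WellSubst-σ₀ {v} p) (there {k = k} {t = B} q) =
  inj₂ (k , refl , subst (_ ∋ k ≤_) (sym (sub-σ₀-↑ v B)) q)
scoped   (WellSubst-σ₀ p) = σ₀-Scoped (Prevalid-head p)
prevalid (WellSubst-σ₀ p) = Prevalid-tail p

sub-→≤ : ∀ {σ Γ Γ' s u w} → WellSubst σ Γ Γ' → Γ ︔ s ⊢ u →≤ w →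
         Γ' ︔ map (sub σ) s ⊢ sub σ u →≤ sub σ w
sub-→≤ {σ} {Γ' = Γ'} ok (r-prom {s = s} {t = B} p q) with bound ok q
... | inj₁ e            =
  subst (Γ' ︔ map (sub σ) s ⊢_→≤ sub σ B) (sym e) (r-eq (sub-Prevalid ok p) (→≡-refl _))
... | inj₂ (_ , e , q') =
  subst (Γ' ︔ map (sub σ) s ⊢_→≤ sub σ B) (sym e) (r-prom (sub-Prevalid ok p) q')
sub-→≤ ok (r-top p)   = r-top (sub-Prevalid ok p)
sub-→≤ ok (r-eq p e)  = r-eq (sub-Prevalid ok p) (→≡-sub (λ x → →≡-refl _) e)
sub-→≤ ok (r-app d)   = r-app (sub-→≤ ok d)
sub-→≤ {σ} ok (r-funop {s = s} d) =
  r-funop (subst (_ ︔_⊢ _ →≤ _) (map-sub-exts-↑ σ s) (sub-→≤ (WellSubst-exts ok (→≤-Prevalid d)) d))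
sub-→≤ ok (r-fun d)   = r-fun (sub-→≤ (WellSubst-exts ok (→≤-Prevalid d)) d)

sub-≤ : ∀ {σ Γ Γ' s u w} → WellSubst σ Γ Γ' → Γ ︔ s ⊢ u ≤ w →
        Γ' ︔ map (sub σ) s ⊢ sub σ u ≤ sub σ w
sub-≤ ok (s-refl p)   = s-refl (sub-Prevalid ok p)
sub-≤ ok (s-step d l) = s-step (sub-→≤ ok d) (sub-≤ ok l)
sub-≤ ok (s-eq l e)   = s-eq (sub-≤ ok l) (→≡-sub (λ x → →≡-refl _) e)

sub-wf : ∀ {σ Γ Γ' s t} → WellSubst σ Γ Γ' → Γ ︔ s ⊢ t wf → Γ' ︔ map (sub σ) s ⊢ sub σ t wf
sub-≤*wf : ∀ {σ Γ Γ' s u w} → WellSubst σ Γ Γ' → Γ ︔ s ⊢ u ≤*wf w →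
           Γ' ︔ map (sub σ) s ⊢ sub σ u ≤*wf sub σ w

sub-wf {σ} {Γ' = Γ'} ok (w-var {s = s} p q D) with bound ok q
... | inj₁ e            = subst (Γ' ︔ map (sub σ) s ⊢_wf) (sym e) (sub-wf ok D)
... | inj₂ (_ , e , q') =
  subst (Γ' ︔ map (sub σ) s ⊢_wf) (sym e) (w-var (sub-Prevalid ok p) q' (sub-wf ok D))
sub-wf ok (w-top p)       = w-top (sub-Prevalid ok p)
sub-wf ok (w-fun Du Dt)   = w-fun (sub-wf (WellSubst-exts ok (wf-Prevalid Du)) Du) (sub-wf ok Dt)
sub-wf {σ} ok (w-funop {s = s} Du Dt) =
  w-funop (subst (_ ︔_⊢ _ wf) (map-sub-exts-↑ σ s) (sub-wf (WellSubst-exts ok (wf-Prevalid Du)) Du))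
          (sub-wf ok Dt)
sub-wf ok (w-app c d)     = w-app (sub-≤*wf ok c) (sub-≤*wf ok d)

sub-≤*wf ok (wf-sub (wf-rule Du Dt l)) = wf-sub (wf-rule (sub-wf ok Du) (sub-wf ok Dt) (sub-≤ ok l))
sub-≤*wf ok (wf-trans c c' D)          = wf-trans (sub-≤*wf ok c) (sub-≤*wf ok c') (sub-wf ok D)

_︔_⊢_→≤*_ : Ctx → Stack → Term → Term → Set
Γ ︔ s ⊢ u →≤* w = Star (Γ ︔ s ⊢_→≤_) u w

wf-instantiate : ∀ {Γ s v b} → (v ∷ Γ) ︔ map ↑ s ⊢ b wf → Γ ︔ s ⊢ b [0:= v ] wf
wf-instantiate {Γ} {s} {v} {b} D =
  subst₂ (Γ ︔_⊢_wf) (map-sub-σ₀-↑ v s) (sym ([0:=]-sub b v))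
    (sub-wf (WellSubst-σ₀ (wf-Prevalid D)) D)

→≤*-instantiate : ∀ {Γ s v b w} → Prevalid (v ∷ Γ) [] → (v ∷ Γ) ︔ map ↑ s ⊢ b →≤* w →
                  Γ ︔ s ⊢ b [0:= v ] →≤* sub (σ₀ v) w
→≤*-instantiate {Γ} {s} {v} {b} {w} p bw =
  subst₂ (Γ ︔_⊢_→≤* sub (σ₀ v) w) (map-sub-σ₀-↑ v s) (sym ([0:=]-sub b v))
    (gmap (sub (σ₀ v)) (sub-→≤ (WellSubst-σ₀ p)) bw)

-- Subtyping reduction commutes with equivalence reduction

top-→≤ : ∀ {Γ s w} → Γ ︔ s ⊢ top →≤ w → w ≡ top
top-→≤ (r-top _)       = refl
top-→≤ (r-eq _ eq-top) = refl

→≤-commute : ∀ {Γ Γ' s s' u w u'} → Γ ⇛ Γ' → s ⇛ s' → Γ ︔ s ⊢ u →≤ w → u →≡ u' →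
             ∃ λ w' → Γ' ︔ s' ⊢ u' →≤* w' × w →≡ w'
→≤-commute-β : ∀ {Γ Γ' s s' t b b' v v' w} → Γ ⇛ Γ' → s ⇛ s' → Γ ︔ (v ∷ s) ⊢ lam t b →≤ w →
               b →≡ b' → v →≡ v' → ∃ λ w' → Γ' ︔ s' ⊢ b' [0:= v' ] →≤* w' × app w v →≡ w'

→≤-commute {u = u} rΓ rs (r-eq p e) e' =
  develop u , r-eq (Prevalid-⇛ rΓ rs p) (→≡-develop e') ◅ ε , →≡-develop e
→≤-commute rΓ rs (r-prom p q) eq-var with ∋-⇛ rΓ q
... | B' , q' , e = B' , r-prom (Prevalid-⇛ rΓ rs p) q' ◅ ε , e
→≤-commute rΓ rs (r-top p) e = top , r-top (Prevalid-⇛ rΓ rs p) ◅ ε , eq-top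
→≤-commute rΓ rs (r-app {v = v} d) eq-topApp =
  top , ε , subst (λ z → app z v →≡ top) (sym (top-→≤ d)) eq-topApp
→≤-commute rΓ rs (r-app d) (eq-app {v' = v'} eu ev) with →≤-commute rΓ (ev ∷ rs) d eu
... | w , uw , e = app w v' , gmap (λ z → app z v') r-app uw , eq-app e ev
→≤-commute rΓ rs (r-app d) (eq-β eb ev) = →≤-commute-β rΓ rs d eb ev
→≤-commute rΓ (eα ∷ rs) (r-funop d) (eq-lam {t' = t'} et eb)
  with →≤-commute (eα ∷ rΓ) (⇛-map-↑ rs) d eb
... | w , bw , e = lam t' w , gmap (lam t') r-funop bw , eq-lam et e
→≤-commute rΓ [] (r-fun d) (eq-lam {t' = t'} et eb) with →≤-commute (et ∷ rΓ) [] d eb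
... | w , bw , e = lam t' w , gmap (lam t') r-fun bw , eq-lam et e

→≤-commute-β rΓ rs (r-top p) eb ev =
  top , r-top (Prevalid-pop (Prevalid-⇛ rΓ (ev ∷ rs) p)) ◅ ε , eq-topApp
→≤-commute-β {t = t} {b = b} {v = v} rΓ rs (r-eq p e) eb ev =
  develop (app (lam t b) v) ,
  r-eq (Prevalid-pop (Prevalid-⇛ rΓ (ev ∷ rs) p)) (→≡-develop (eq-β {t = t} eb ev)) ◅ ε ,
  →≡-develop (eq-app e (→≡-refl v))
→≤-commute-β {v' = v'} rΓ rs (r-funop d) eb ev with →≤-commute (ev ∷ rΓ) (⇛-map-↑ rs) d eb
... | w , bw , e =
  sub (σ₀ v') w , →≤*-instantiate (Prevalid-⇛ (ev ∷ rΓ) [] (→≤-Prevalid d)) bw , →≡-β e ev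

→≤*-commute : ∀ {Γ Γ' s s' u w u'} → Γ ⇛ Γ' → s ⇛ s' → Γ ︔ s ⊢ u →≤* w → u →≡ u' →
              ∃ λ w' → Γ' ︔ s' ⊢ u' →≤* w' × w →≡ w'
→≤*-commute {u' = u'} rΓ rs ε e = u' , ε , e
→≤*-commute rΓ rs (d ◅ ds) e with →≤-commute rΓ rs d e
... | w₁ , uw₁ , e₁ with →≤*-commute rΓ rs ds e₁
... | w₂ , w₁w₂ , e₂ = w₂ , uw₁ ◅◅ w₁w₂ , e₂

≤⇒→≤* : ∀ {Γ s u t} → Γ ︔ s ⊢ u ≤ t → ∃ λ w → Γ ︔ s ⊢ u →≤* w × t →≡* w
≤⇒→≤* {t = t} (s-refl p) = t , ε , ε
≤⇒→≤* (s-step d l) with ≤⇒→≤* l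
... | w , uw , tw = w , d ◅ uw , tw
≤⇒→≤* (s-eq l e) with ≤⇒→≤* l
... | w , uw , tw = w , uw , e ◅ tw

→≤*⇒≤ : ∀ {Γ s u w t} → Prevalid Γ s → Γ ︔ s ⊢ u →≤* w → t →≡* w → Γ ︔ s ⊢ u ≤ t
→≤*⇒≤ p ε        ε        = s-refl p
→≤*⇒≤ p ε        (e ◅ tw) = s-eq (→≤*⇒≤ p ε tw) e
→≤*⇒≤ p (d ◅ uw) tw       = s-step d (→≤*⇒≤ p uw tw)

≤-reduce : ∀ {Γ Γ' s s' u u' t t'} → Γ ⇛ Γ' → s ⇛ s' → Γ ︔ s ⊢ u ≤ t → u →≡ u' → t →≡ t' →
           Γ' ︔ s' ⊢ u' ≤ t'
≤-reduce rΓ rs l eu et with ≤⇒→≤* l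
... | w , uw , tw with →≤*-commute rΓ rs uw eu
... | w' , u'w' , ww' with →≡-strip et (tw ◅◅ ww' ◅ ε)
... | d , t'd , w'd = →≤*⇒≤ p (u'w' ◅◅ r-eq p w'd ◅ ε) t'd
  where
  p = Prevalid-⇛ rΓ rs (≤-Prevalid l)

-- Stability of the well-formedness judgements

wf-reduce : ∀ {Γ Γ' s s' t t'} → Γ ⇛ Γ' → s ⇛ s' → Γ ︔ s ⊢ t wf → t →≡ t' → Γ' ︔ s' ⊢ t' wf
≤*wf-reduce : ∀ {Γ Γ' s s' u u' t t'} → Γ ⇛ Γ' → s ⇛ s' → Γ ︔ s ⊢ u ≤*wf t →
              u →≡ u' → t →≡ t' → Γ' ︔ s' ⊢ u' ≤*wf t'
wf-β-redex : ∀ {Γ Γ' s s' a b b' v v' t} → Γ ⇛ Γ' → s ⇛ s' → Γ ︔ (v ∷ s) ⊢ lam a b ≤*wf t →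
             b →≡ b' → v →≡ v' → Γ' ︔ s' ⊢ b' [0:= v' ] wf

wf-reduce rΓ rs (w-var p q D) eq-var with ∋-⇛ rΓ q
... | _ , q' , e = w-var (Prevalid-⇛ rΓ rs p) q' (wf-reduce rΓ rs D e)
wf-reduce rΓ rs (w-top p) eq-top = w-top (Prevalid-⇛ rΓ rs p)
wf-reduce rΓ [] (w-fun Du Dt) (eq-lam et eu) =
  w-fun (wf-reduce (et ∷ rΓ) [] Du eu) (wf-reduce rΓ [] Dt et)
wf-reduce rΓ (eδ ∷ rs) (w-funop Du Dt) (eq-lam et eu) =
  w-funop (wf-reduce (eδ ∷ rΓ) (⇛-map-↑ rs) Du eu) (wf-reduce rΓ [] Dt et)
wf-reduce rΓ rs (w-app c _) eq-topApp = w-top (Prevalid-⇛ rΓ rs (Prevalid-pop (≤*wf-Prevalid c)))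
wf-reduce rΓ rs (w-app {t = t} c d) (eq-app eu ev) =
  w-app (≤*wf-reduce rΓ (ev ∷ rs) c eu (→≡-refl (lam t top))) (≤*wf-reduce rΓ [] d ev (→≡-refl t))
wf-reduce rΓ rs (w-app c _) (eq-β eb ev) = wf-β-redex rΓ rs c eb ev

≤*wf-reduce rΓ rs (wf-sub (wf-rule Du Dt l)) eu et =
  wf-sub (wf-rule (wf-reduce rΓ rs Du eu) (wf-reduce rΓ rs Dt et) (≤-reduce rΓ rs l eu et))
≤*wf-reduce rΓ rs (wf-trans {u = m} c c' Dm) eu et =
  wf-trans (≤*wf-reduce rΓ rs c eu (→≡-refl m)) (≤*wf-reduce rΓ rs c' (→≡-refl m) et)
           (wf-reduce rΓ rs Dm (→≡-refl m))

wf-β-redex rΓ rs (wf-sub (wf-rule (w-funop Db _) _ _)) eb ev =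
  wf-instantiate (wf-reduce (ev ∷ rΓ) (⇛-map-↑ rs) Db eb)
wf-β-redex rΓ rs (wf-trans c _ _) eb ev = wf-β-redex rΓ rs c eb ev

↦⇒→≡ : ∀ {t t'} → t ↦ t' → t →≡ t'
↦⇒→≡ (β {u = u} {v = v}) = eq-β (→≡-refl u) (→≡-refl v)
↦⇒→≡ (lamL {u = u} p)    = eq-lam (↦⇒→≡ p) (→≡-refl u)
↦⇒→≡ (lamR {t = t} p)    = eq-lam (→≡-refl t) (↦⇒→≡ p)
↦⇒→≡ (appL {u = u} p)    = eq-app (↦⇒→≡ p) (→≡-refl u)
↦⇒→≡ (appR {u = u} p)    = eq-app (→≡-refl u) (↦⇒→≡ p)

theorem4p2 : (Γ : Ctx) (s : Stack) (t t' u : Term) →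
    Γ ︔ s ⊢ t ≤*wf u → t ↦ t' → Γ ︔ s ⊢ t' ≤*wf u
theorem4p2 Γ s t t' u t≤u t↦t' =
  ≤*wf-reduce (⇛-refl Γ) (⇛-refl s) t≤u (↦⇒→≡ t↦t') (→≡-refl u)
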